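{- Let $M$ and $n$ be positive integers with $M>1$ and let $p$ be an odd prime. Then the following two conditions are equivalent: (i) $p^n\mid M^{p-1}-1$ and $p^n>\sqrt{M}$; (ii) $M=Ap^n+w_n$ where $w_n$ and $A$ are integers such that $0<w_n<p^n$, $w_n^{p-1}\equiv 1\pmod{p^n}$, and $0\le A<p^n$. -}

module Defs where

open import Data.Nat using (ℕ; _*_; _<_)

-- "√M < q" for natural numbers M, q ≥ 0: since both sides are nonnegative,
-- √M < q  ⇔  M < q².  (ℕ has no square root of non-squares, so we state it this way.)
SqrtLt : ℕ → ℕ → Set
SqrtLt M q = M < q * q

-- A number M < q² is exactly a two-digit numeral A q + w in base q, and M ≡ w (mod q),
-- so M^k ≡ 1 (mod q) iff w^k ≡ 1 (mod q). The only extra point is w ≠ 0, which holds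
-- because 0^k ≢ 1 (mod q) for k > 0 and q > 1.
module Submission where

open import Defs
open import Data.Nat using (ℕ; _>_; _^_; _∸_)
open import Data.Nat.Primality using (Prime)
open import Data.Integer using (ℤ; +_; _+_; _*_; _-_; _≤_; _<_)
open import Data.Integer.Divisibility using (_∣_)
open import Data.Product using (∃; ∃-syntax; _×_; _,_)
open import Function.Bundles using (_⇔_; mk⇔; Equivalence)
open import Relation.Nullary using (¬_)
open import Relation.Binary.PropositionalEquality using (_≡_; refl; sym; trans; cong; subst; module ≡-Reasoning)
open import Data.Empty using (⊥-elim)

import Data.Nat as ℕ
import Data.Nat.Properties as ℕ
import Data.Nat.DivMod as ℕ
import Data.Nat.Divisibility as ℕ
open import Data.Nat.Primality using (prime⇒nonTrivial)
import Data.Integer as ℤ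
import Data.Integer.Properties as ℤ
import Data.Integer.Divisibility.Signed as Signed
open import Data.Integer.Tactic.RingSolver using (solve-∀)

x-y∣xᵏ-yᵏ : ∀ x y k → (x - y) Signed.∣ (x ℤ.^ k - y ℤ.^ k)
x-y∣xᵏ-yᵏ x y ℕ.zero    = Signed.divides (+ 0) refl
x-y∣xᵏ-yᵏ x y (ℕ.suc k) with x-y∣xᵏ-yᵏ x y k
... | Signed.divides c eq = Signed.divides (x * c + y ℤ.^ k) (begin
  x * x ℤ.^ k - y * y ℤ.^ k                 ≡⟨ split x y (x ℤ.^ k) (y ℤ.^ k) ⟩
  x * (x ℤ.^ k - y ℤ.^ k) + (x - y) * y ℤ.^ k ≡⟨ cong (λ t → x * t + (x - y) * y ℤ.^ k) eq ⟩
  x * (c * (x - y)) + (x - y) * y ℤ.^ k       ≡⟨ factor x y c (y ℤ.^ k) ⟩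
  (x * c + y ℤ.^ k) * (x - y)                 ∎)
  where
  open ≡-Reasoning
  split : ∀ x y a b → x * a - y * b ≡ x * (a - b) + (x - y) * b
  split = solve-∀
  factor : ∀ x y c b → x * (c * (x - y)) + (x - y) * b ≡ (x * c + b) * (x - y)
  factor = solve-∀

infix 4 _≡_mod_

_≡_mod_ : ℤ → ℤ → ℕ → Set
x ≡ y mod q = + q ∣ x - y

module _ {q : ℕ} where

  a*q+w≡w-mod : ∀ a w → a * + q + w ≡ w mod q
  a*q+w≡w-mod a w = Signed.∣⇒∣ᵤ (Signed.divides a (cancel a (+ q) w))
    where
    cancel : ∀ a q w → (a * q + w) - w ≡ a * q
    cancel = solve-∀

  pow≡1-mod-resp : ∀ x y k → x ≡ y mod q → (x ℤ.^ k ≡ + 1 mod q ⇔ y ℤ.^ k ≡ + 1 mod q)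
  pow≡1-mod-resp x y k x≡y = mk⇔
    (λ xᵏ≡1 → Signed.∣⇒∣ᵤ (subst (+ q Signed.∣_) (drop-first (x ℤ.^ k) (y ℤ.^ k))
                (Signed.∣m∣n⇒∣m-n (Signed.∣ᵤ⇒∣ {+ q} {x ℤ.^ k - + 1} xᵏ≡1) xᵏ≡yᵏ)))
    (λ yᵏ≡1 → Signed.∣⇒∣ᵤ (subst (+ q Signed.∣_) (telescope (x ℤ.^ k) (y ℤ.^ k))
                (Signed.∣m∣n⇒∣m+n xᵏ≡yᵏ (Signed.∣ᵤ⇒∣ {+ q} {y ℤ.^ k - + 1} yᵏ≡1))))
    where
    xᵏ≡yᵏ : + q Signed.∣ (x ℤ.^ k - y ℤ.^ k)
    xᵏ≡yᵏ = Signed.∣-trans (Signed.∣ᵤ⇒∣ {+ q} {x - y} x≡y) (x-y∣xᵏ-yᵏ x y k)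
    drop-first : ∀ a b → (a - + 1) - (a - b) ≡ b - + 1
    drop-first = solve-∀
    telescope : ∀ a b → (a - b) + (b - + 1) ≡ a - + 1
    telescope = solve-∀

  pow≡1-mod⇒pos : ∀ {k} w → 0 ℕ.< k → 1 ℕ.< q → (+ w) ℤ.^ k ≡ + 1 mod q → + 0 < + w
  pow≡1-mod⇒pos ℕ.zero    (ℕ.s≤s ℕ.z≤n) 1<q q∣1 = ⊥-elim (ℕ.<-irrefl (sym (ℕ.∣1⇒≡1 q∣1)) 1<q)
  pow≡1-mod⇒pos (ℕ.suc w) _             _   _   = ℤ.+<+ ℕ.z<s

pos-*-+ : ∀ a q w → + (a ℕ.* q ℕ.+ w) ≡ + a * + q + + w
pos-*-+ a q w = trans (ℤ.pos-+ (a ℕ.* q) w) (cong (_+ + w) (ℤ.pos-* a q))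

a*q+w<q*q : ∀ {a q w} → a ℕ.< q → w ℕ.< q → a ℕ.* q ℕ.+ w ℕ.< q ℕ.* q
a*q+w<q*q {a} {q} {w} a<q w<q = begin-strict
  a ℕ.* q ℕ.+ w ≡⟨ ℕ.+-comm (a ℕ.* q) w ⟩
  w ℕ.+ a ℕ.* q <⟨ ℕ.+-monoˡ-< (a ℕ.* q) w<q ⟩
  ℕ.suc a ℕ.* q ≤⟨ ℕ.*-monoˡ-≤ q a<q ⟩
  q ℕ.* q       ∎
  where open ℕ.≤-Reasoning

RootOfUnityBelowSquare : ℕ → ℕ → ℕ → Set
RootOfUnityBelowSquare k q M = (+ M) ℤ.^ k ≡ + 1 mod q × SqrtLt M q

TwoDigitRootOfUnity : ℕ → ℕ → ℕ → Set
TwoDigitRootOfUnity k q M = ∃[ A ] ∃[ w ]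
  ((+ M ≡ A * + q + w) × (+ 0 < w) × (w < + q) × (w ℤ.^ k ≡ + 1 mod q) × (+ 0 ≤ A) × (A < + q))

rootOfUnityBelowSquare⇔twoDigitRootOfUnity : ∀ {q} k M → 1 ℕ.< q → 0 ℕ.< k →
  RootOfUnityBelowSquare k q M ⇔ TwoDigitRootOfUnity k q M
rootOfUnityBelowSquare⇔twoDigitRootOfUnity {q} k M 1<q 0<k = mk⇔ to from
  where
  instance
    q≢0 : ℕ.NonZero q
    q≢0 = ℕ.>-nonZero (ℕ.<-trans ℕ.z<s 1<q)

  to : RootOfUnityBelowSquare k q M → TwoDigitRootOfUnity k q M
  to (Mᵏ≡1 , M<q²) =
    + (M ℕ./ q) , + (M ℕ.% q) , M≡ , pow≡1-mod⇒pos (M ℕ.% q) 0<k 1<q wᵏ≡1 ,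
    ℤ.+<+ (ℕ.m%n<n M q) , wᵏ≡1 , ℤ.+≤+ ℕ.z≤n , ℤ.+<+ (ℕ.m<n*o⇒m/o<n M<q²)
    where
    M≡ : + M ≡ + (M ℕ./ q) * + q + + (M ℕ.% q)
    M≡ = trans (cong +_ (trans (ℕ.m≡m%n+[m/n]*n M q) (ℕ.+-comm (M ℕ.% q) _)))
               (pos-*-+ (M ℕ./ q) q (M ℕ.% q))
    M≡w : + M ≡ + (M ℕ.% q) mod q
    M≡w = subst (_≡ + (M ℕ.% q) mod q) (sym M≡) (a*q+w≡w-mod (+ (M ℕ./ q)) (+ (M ℕ.% q)))
    wᵏ≡1 : (+ (M ℕ.% q)) ℤ.^ k ≡ + 1 mod q
    wᵏ≡1 = Equivalence.to (pow≡1-mod-resp (+ M) (+ (M ℕ.% q)) k M≡w) Mᵏ≡1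

  from : TwoDigitRootOfUnity k q M → RootOfUnityBelowSquare k q M
  from (+ a , + w , M≡ , _ , ℤ.+<+ w<q , wᵏ≡1 , _ , ℤ.+<+ a<q) =
    Equivalence.from (pow≡1-mod-resp (+ M) (+ w) k M≡w) wᵏ≡1 , M<q²
    where
    M≡w : + M ≡ + w mod q
    M≡w = subst (_≡ + w mod q) (sym M≡) (a*q+w≡w-mod (+ a) (+ w))
    M<q² : M ℕ.< q ℕ.* q
    M<q² = subst (ℕ._< q ℕ.* q) (ℤ.+-injective (trans (pos-*-+ a q w) (sym M≡))) (a*q+w<q*q a<q w<q)

proposition1p1 : (M n p : ℕ) → M > 1 → n > 0 → Prime p → ¬ (p ≡ 2) →
    ((+ (p ^ n) ∣ ((+ M) Data.Integer.^ (p ∸ 1) - + 1)) × SqrtLt M (p ^ n))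
    ⇔ (∃[ A ] ∃[ w ] ((+ M ≡ A * + (p ^ n) + w) × (+ 0 < w) × (w < + (p ^ n)) × (+ (p ^ n) ∣ (w Data.Integer.^ (p ∸ 1) - + 1)) × (+ 0 ≤ A) × (A < + (p ^ n))))
proposition1p1 M n p _ n>0 p-prime _ =
  rootOfUnityBelowSquare⇔twoDigitRootOfUnity (p ∸ 1) M (ℕ.^-monoʳ-< p 1<p n>0) (ℕ.m<n⇒0<n∸m 1<p)
  where
  1<p : 1 ℕ.< p
  1<p = ℕ.nonTrivial⇒n>1 p {{prime⇒nonTrivial p-prime}}
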